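{- Let $P$ be the definite logic program consisting of the four clauses $pqs(0,\_,\_,\_).$ $pqs(s(I),Cs,Us,[\_|Ds]) \leftarrow pqs(I,Cs,[\_|Us],Ds),\ pq(s(I),Cs,Us,Ds).$ $pq(I,[I|\_],[I|\_],[I|\_]).$ $pq(I,[\_|Cs],[\_|Us],[\_|Ds]) \leftarrow pq(I,Cs,Us,Ds).$ Then $P$ is complete w.r.t. the specification $S^0=S_{pq}\cup S^0_{pqs}\cup\{\,pqs(0,cs,us,ds)\mid cs,us,ds\in\mathcal{HU}\,\}$, i.e. $S^0\subseteq\mathcal{M}_P$, where $S_{pq}=\{\,pq(i,[c_1,\ldots,c_k,i|c],[u_1,\ldots,u_k,i|u],[d_1,\ldots,d_k,i|d])\in\mathcal{HB}\mid k\geq 0\,\}$ and $S^0_{pqs}=\{\,pqs(i,cs,us,[t|ds])\in\mathcal{HB}\mid i>0 \text{ and } (cs,us,ds) \text{ is correct up to } i \text{ w.r.t. } i\,\}$ (here $i$ ranges over natural numbers, identified with the terms $s^i(0)$). In particular $P$ is complete w.r.t. $S^0_{pqs}$.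
   Context: Programs are definite clause programs over a fixed alphabet of function symbols (including $0$, $s$, and the list constructors $[\,]$, $[\cdot|\cdot]$) and predicate symbols (including $pq$, $pqs$, each of arity 4); "_" denotes an anonymous variable. $\mathcal{HU}$ is the Herbrand universe (set of ground terms), $\mathcal{HB}$ the Herbrand base, and $\mathcal{M}_P$ the least Herbrand model of $P$. A specification is a set $S\subseteq\mathcal{HB}$; $P$ is complete w.r.t. $S$ when $S\subseteq\mathcal{M}_P$. Prolog list notation is used: $[e_1,\ldots,e_n|e]$ stands for $e$ when $n=0$; a list of length $n$ is a term $[e_1,\ldots,e_n]$. A term $e$ is the $k$-th member ($k>0$) of a term $t$ if $t=[e_1,\ldots,e_{k-1},e|e']$ for some terms $e_1,\ldots,e_{k-1},e'$; $e$ is a member of $t$ if it is its $k$-th member for some $k>0$. A list of distinct members is a list whose members are pairwise distinct. If a number $j$ is the $k$-th member of a list $cs$, the up diagonal number of $j$ w.r.t. $i$ in $cs$ is $k+j-i$ and the down diagonal number is $k+i-j$. A triple of terms $(cs,us,ds)$ is correct up to $m$ w.r.t. $i$ when $0\leq m\leq i$ and: $cs$ is a list of distinct members and each $j\in\{1,\ldots,m\}$ is a member of $cs$; the up diagonal numbers of $1,\ldots,m$ in $cs$ are pairwise distinct, and so are the down diagonal numbers; and for each $j\in\{1,\ldots,m\}$, if the up (respectively down) diagonal number of $j$ w.r.t. $i$ in $cs$ is $l>0$ then the $l$-th member of $us$ (respectively $ds$) is $j$. -}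

module Defs where

open import Data.Nat using (ℕ; zero; suc; _≤_; _<_)
open import Data.Integer as ℤ using (ℤ; +_)
open import Data.Vec using (Vec; []; _∷_)
open import Data.Product using (Σ; ∃; ∃-syntax; _×_; _,_)
open import Data.Sum using (_⊎_)
open import Relation.Binary.PropositionalEquality using (_≡_; _≢_)

-- A fixed alphabet of function symbols: the four distinguished symbols
-- 0, s, [], [.|.] plus an arbitrary set of further symbols with arities.
record Signature : Set₁ where
  field
    Sym   : Set
    arity : Sym → ℕ

data Term (Σs : Signature) : Set where
  zro  : Term Σs
  s    : Term Σs → Term Σs
  nil  : Term Σs
  cons : Term Σs → Term Σs → Term Σs
  app  : (f : Signature.Sym Σs) → Vec (Term Σs) (Signature.arity Σs f) → Term Σs

module _ {Σs : Signature} where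

  num : ℕ → Term Σs
  num zero    = zro
  num (suc n) = s (num n)

  prefix : ∀ {k} → Vec (Term Σs) k → Term Σs → Term Σs
  prefix []       e = e
  prefix (x ∷ xs) e = cons x (prefix xs e)

  data Atom : Set where
    pq  : Term Σs → Term Σs → Term Σs → Term Σs → Atom
    pqs : Term Σs → Term Σs → Term Σs → Term Σs → Atom

  -- Least Herbrand model M_P of the program P (inductively: closure under
  -- ground instances of the four clauses).
  data MP : Atom → Set where
    c1 : ∀ cs us ds → MP (pqs zro cs us ds)
    c2 : ∀ i cs us ds x y →
         MP (pqs i cs (cons y us) ds) → MP (pq (s i) cs us ds) →
         MP (pqs (s i) cs us (cons x ds))
    c3 : ∀ i c u d → MP (pq i (cons i c) (cons i u) (cons i d))
    c4 : ∀ i cs us ds x y z →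
         MP (pq i cs us ds) → MP (pq i (cons x cs) (cons y us) (cons z ds))

  data KthMember : ℕ → Term Σs → Term Σs → Set where
    here  : ∀ {e t} → KthMember 1 e (cons e t)
    there : ∀ {k e x t} → KthMember k e t → KthMember (suc k) e (cons x t)

  Member : Term Σs → Term Σs → Set
  Member e t = ∃[ k ] KthMember k e t

  data IsList : Term Σs → Set where
    nilL  : IsList nil
    consL : ∀ {x t} → IsList t → IsList (cons x t)

  DistinctList : Term Σs → Set
  DistinctList cs = IsList cs ×
    (∀ k k' e e' → KthMember k e cs → KthMember k' e' cs → k ≢ k' → e ≢ e')

  upDiag : ℕ → ℕ → ℕ → ℤ
  upDiag k j i = (+ k ℤ.+ + j) ℤ.- + i

  downDiag : ℕ → ℕ → ℕ → ℤ
  downDiag k j i = (+ k ℤ.+ + i) ℤ.- + j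

  CorrectUpTo : ℕ → ℕ → Term Σs → Term Σs → Term Σs → Set
  CorrectUpTo m i cs us ds =
    m ≤ i ×
    DistinctList cs ×
    (∀ j → 1 ≤ j → j ≤ m → Member (num j) cs) ×
    (∀ j j' k k' → 1 ≤ j → j ≤ m → 1 ≤ j' → j' ≤ m → j ≢ j' →
       KthMember k (num j) cs → KthMember k' (num j') cs →
       upDiag k j i ≢ upDiag k' j' i) ×
    (∀ j j' k k' → 1 ≤ j → j ≤ m → 1 ≤ j' → j' ≤ m → j ≢ j' →
       KthMember k (num j) cs → KthMember k' (num j') cs →
       downDiag k j i ≢ downDiag k' j' i) ×
    (∀ j k l → 1 ≤ j → j ≤ m → KthMember k (num j) cs → 0 < l →
       upDiag k j i ≡ + l → KthMember l (num j) us) ×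
    (∀ j k l → 1 ≤ j → j ≤ m → KthMember k (num j) cs → 0 < l →
       downDiag k j i ≡ + l → KthMember l (num j) ds)

  data Spq : Atom → Set where
    spq : ∀ k i (cs us ds : Vec (Term Σs) k) c u d →
          Spq (pq i (prefix cs (cons i c)) (prefix us (cons i u)) (prefix ds (cons i d)))

  data S0pqs : Atom → Set where
    s0pqs : ∀ i cs us t ds → 0 < i → CorrectUpTo i i cs us ds →
            S0pqs (pqs (num i) cs us (cons t ds))

  data Spqs0 : Atom → Set where
    spqs0 : ∀ cs us ds → Spqs0 (pqs zro cs us ds)

  S0 : Atom → Set
  S0 a = Spq a ⊎ S0pqs a ⊎ Spqs0 a

module Submission where

-- Atoms of S_pq are derived by peeling the common prefix with clause 4 and
-- closing with clause 3; pqs(0,…) is clause 1.  The heart is S⁰_pqs, proved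
-- by induction on i.  If (cs,us,[t|ds]) is correct up to i+1 w.r.t. i+1, the
-- numeral i+1 sits at the same position k in cs, us and ds (its diagonal
-- numbers w.r.t. its own row are k), so pq(i+1,cs,us,ds) holds.  For the
-- recursive premise pqs(i,cs,[y|us],ds) we choose the head y of the new
-- up-diagonal list: if some queen j ≤ i lies on up diagonal 1 w.r.t. row i,
-- y is that (unique) j, otherwise y is arbitrary.  Moving the reference row
-- from i+1 to i shifts up diagonal numbers by +1 and down ones by -1, which is
-- exactly compensated by consing y onto us and dropping t from [t|ds]; hence
-- (cs,[y|us],ds) is correct up to i w.r.t. i and the induction hypothesis
-- applies.

open import Defs
open import Data.Nat as ℕ using (ℕ; zero; suc; _≤_; _<_; z≤n; s≤s; _≟_; _≤?_)
import Data.Nat.Properties as ℕP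
open import Data.Integer as ℤ using (ℤ; +_)
import Data.Integer.Properties as ℤP
open import Algebra.Bundles using (AbelianGroup)
open import Algebra.Properties.Group (AbelianGroup.group ℤP.+-0-abelianGroup) using (∙-cancelʳ; //-rightDividesˡ; //-rightDividesʳ)
open import Algebra.Properties.CommutativeSemigroup ℤP.+-commutativeSemigroup using (xy∙z≈xz∙y)
open import Data.Vec using (Vec; []; _∷_)
open import Data.Product using (∃-syntax; _×_; _,_)
open import Data.Sum using (inj₁; inj₂)
open import Data.Empty using (⊥-elim)
open import Relation.Nullary using (Dec; yes; no)
open import Relation.Nullary.Decidable using (map′; _×-dec_)
open import Relation.Binary.PropositionalEquality

minus≡⇒ : ∀ m n {l} → + m ℤ.- + n ≡ + l → m ≡ l ℕ.+ n
minus≡⇒ m n {l} eq = ℤP.+-injective (begin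
  + m                    ≡⟨ //-rightDividesˡ (+ n) (+ m) ⟨
  (+ m ℤ.- + n) ℤ.+ + n  ≡⟨ cong (ℤ._+ + n) eq ⟩
  + l ℤ.+ + n            ∎)
  where open ≡-Reasoning

minus≡⇐ : ∀ m n {l} → m ≡ l ℕ.+ n → + m ℤ.- + n ≡ + l
minus≡⇐ m n {l} refl = //-rightDividesʳ (+ n) (+ l)

translate : ∀ (x y : ℤ) c c' → x ℤ.+ c ≡ y ℤ.+ c → x ℤ.+ c' ≡ y ℤ.+ c'
translate x y c c' eq = cong (ℤ._+ c') (∙-cancelʳ c x y eq)

module _ {Σs : Signature} where

  T : Set
  T = Term Σs

  -- A queen on its own row i has both diagonal numbers equal to its position
  -- k (downDiag k i i is literally the same expression as upDiag k i i).
  diag-self : ∀ k i → upDiag {Σs} k i i ≡ + k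
  diag-self k i = minus≡⇐ (k ℕ.+ i) i refl

  upDiag-indep : ∀ k j k' j' i i' → upDiag {Σs} k j i ≡ upDiag {Σs} k' j' i →
                 upDiag {Σs} k j i' ≡ upDiag {Σs} k' j' i'
  upDiag-indep k j k' j' i i' =
    translate (+ k ℤ.+ + j) (+ k' ℤ.+ + j') (ℤ.- + i) (ℤ.- + i')

  downDiag-indep : ∀ k j k' j' i i' → downDiag {Σs} k j i ≡ downDiag {Σs} k' j' i →
                   downDiag {Σs} k j i' ≡ downDiag {Σs} k' j' i'
  downDiag-indep k j k' j' i i' eq = begin
    downDiag {Σs} k j i'             ≡⟨ regroup k j i' ⟩
    (+ k ℤ.- + j) ℤ.+ + i'      ≡⟨ translate (+ k ℤ.- + j) (+ k' ℤ.- + j') (+ i) (+ i') (begin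
      (+ k ℤ.- + j) ℤ.+ + i       ≡⟨ regroup k j i ⟨
      downDiag {Σs} k j i              ≡⟨ eq ⟩
      downDiag {Σs} k' j' i            ≡⟨ regroup k' j' i ⟩
      (+ k' ℤ.- + j') ℤ.+ + i     ∎) ⟩
    (+ k' ℤ.- + j') ℤ.+ + i'    ≡⟨ regroup k' j' i' ⟨
    downDiag {Σs} k' j' i'           ∎
    where
      open ≡-Reasoning
      regroup : ∀ k j i → downDiag {Σs} k j i ≡ (+ k ℤ.- + j) ℤ.+ + i
      regroup k j i = xy∙z≈xz∙y (+ k) (+ i) (ℤ.- + j)

  upDiag-step : ∀ k j i {l} → upDiag {Σs} k j i ≡ + suc l → upDiag {Σs} k j (suc i) ≡ + l
  upDiag-step k j i {l} eq =
    minus≡⇐ (k ℕ.+ j) (suc i) (trans (minus≡⇒ (k ℕ.+ j) i eq) (sym (ℕP.+-suc l i)))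

  downDiag-step : ∀ k j i {l} → downDiag {Σs} k j i ≡ + l → downDiag {Σs} k j (suc i) ≡ + suc l
  downDiag-step k j i eq =
    minus≡⇐ (k ℕ.+ suc i) j (trans (ℕP.+-suc k i) (cong suc (minus≡⇒ (k ℕ.+ i) j eq)))

  upDiag-zero : ∀ k j i → k ℕ.+ j ≡ i → upDiag {Σs} k j i ≡ + 0
  upDiag-zero k j i = minus≡⇐ (k ℕ.+ j) i

  position-positive : ∀ {k} {e t : T} → KthMember k e t → 0 < k
  position-positive here      = s≤s z≤n
  position-positive (there _) = s≤s z≤n

  kthMember-cons : ∀ {k} {e t : T} → KthMember k e t → ∃[ x ] ∃[ r ] t ≡ cons x r
  kthMember-cons here      = _ , _ , refl
  kthMember-cons (there _) = _ , _ , refl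

  kthMember-tail : ∀ {l} {e x t : T} → KthMember (suc (suc l)) e (cons x t) → KthMember (suc l) e t
  kthMember-tail (there p) = p

  pq-prefix : ∀ {k} i (cs us ds : Vec T k) c u d →
              MP (pq i (prefix cs (cons i c)) (prefix us (cons i u)) (prefix ds (cons i d)))
  pq-prefix i []       []       []       c u d = c3 i c u d
  pq-prefix i (x ∷ cs) (y ∷ us) (z ∷ ds) c u d = c4 _ _ _ _ x y z (pq-prefix i cs us ds c u d)

  pq-at : ∀ {k} {e cs us ds : T} → KthMember k e cs → KthMember k e us → KthMember k e ds →
          MP (pq e cs us ds)
  pq-at here      here      here      = c3 _ _ _ _
  pq-at (there p) (there q) (there r) = c4 _ _ _ _ _ _ _ (pq-at p q r)
  pq-at here      (there ()) _
  pq-at here      here      (there ())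
  pq-at (there ()) here     _
  pq-at (there p) (there q) here with () ← position-positive p

  -- Equality with a numeral is decidable (terms in general need not be, as
  -- the extra function symbols are arbitrary).
  num? : ∀ n (t : T) → Dec (t ≡ num n)
  num? zero    zro        = yes refl
  num? (suc n) (s t)      = map′ (cong s) (λ { refl → refl }) (num? n t)
  num? zero    (s _)      = no λ ()
  num? zero    nil        = no λ ()
  num? zero    (cons _ _) = no λ ()
  num? zero    (app _ _)  = no λ ()
  num? (suc n) zro        = no λ ()
  num? (suc n) nil        = no λ ()
  num? (suc n) (cons _ _) = no λ ()
  num? (suc n) (app _ _)  = no λ ()

  OnAntiDiagonal : ℕ → T → Set
  OnAntiDiagonal n t = ∃[ j ] ∃[ k ] 1 ≤ j × KthMember k (num j) t × k ℕ.+ j ≡ n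

  onAntiDiagonal? : ∀ n (t : T) → Dec (OnAntiDiagonal n t)
  onAntiDiagonal? zero t = no λ { (_ , _ , _ , here , ()) ; (_ , _ , _ , there _ , ()) }
  onAntiDiagonal? (suc n) (cons x t) with (1 ≤? n) ×-dec num? n x | onAntiDiagonal? n t
  ... | yes (1≤n , refl) | _ = yes (n , 1 , 1≤n , here , refl)
  ... | no _ | yes (j , k , 1≤j , p , e) = yes (j , suc k , 1≤j , there p , cong suc e)
  ... | no ¬atHead | no ¬inTail = no λ where
    (j , _ , 1≤j , here , refl) → ¬atHead (1≤j , refl)
    (j , _ , 1≤j , there p , e) → ¬inTail (j , _ , 1≤j , p , ℕP.suc-injective e)
  onAntiDiagonal? (suc n) zro       = no λ { (_ , _ , _ , () , _) }
  onAntiDiagonal? (suc n) (s _)     = no λ { (_ , _ , _ , () , _) }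
  onAntiDiagonal? (suc n) nil       = no λ { (_ , _ , _ , () , _) }
  onAntiDiagonal? (suc n) (app _ _) = no λ { (_ , _ , _ , () , _) }

  UpDistinct : ℕ → ℕ → T → Set
  UpDistinct m i cs = ∀ j j' k k' → 1 ≤ j → j ≤ m → 1 ≤ j' → j' ≤ m → j ≢ j' →
    KthMember k (num j) cs → KthMember k' (num j') cs → upDiag {Σs} k j i ≢ upDiag {Σs} k' j' i

  UpHead : ℕ → T → T → Set
  UpHead i cs y = ∀ j k → 1 ≤ j → j ≤ i → KthMember k (num j) cs →
    upDiag {Σs} k j i ≡ + 1 → y ≡ num j

  upHead : ∀ i cs → UpDistinct (suc i) (suc i) cs → ∃[ y ] UpHead i cs y
  upHead i cs distinct with onAntiDiagonal? (suc i) cs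
  ... | no none =
    zro , λ j k 1≤j _ p d → ⊥-elim (none (j , k , 1≤j , p , minus≡⇒ (k ℕ.+ j) i d))
  ... | yes (j₀ , k₀ , 1≤j₀ , p₀ , e₀) = num j₀ , forced
    where
      forced : UpHead i cs (num j₀)
      forced j k 1≤j j≤i p d with j₀ ≟ j
      ... | yes j₀≡j = cong num j₀≡j
      ... | no j₀≢j = ⊥-elim (distinct j₀ j k₀ k 1≤j₀ j₀≤1+i 1≤j (ℕP.m≤n⇒m≤1+n j≤i) j₀≢j p₀ p sameDiagonal)
        where
          j₀≤1+i : j₀ ≤ suc i
          j₀≤1+i = subst (j₀ ≤_) e₀ (ℕP.m≤n+m j₀ k₀)

          -- Both queens lie on the anti-diagonal k + j = i + 1.
          sameDiagonal : upDiag {Σs} k₀ j₀ (suc i) ≡ upDiag {Σs} k j (suc i)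
          sameDiagonal = trans (upDiag-zero k₀ j₀ (suc i) e₀)
                               (sym (upDiag-zero k j (suc i) (minus≡⇒ (k ℕ.+ j) i d)))

  correct-pred : ∀ {i cs us t ds y} → CorrectUpTo (suc i) (suc i) cs us (cons t ds) →
                 UpHead i cs y → CorrectUpTo i i cs (cons y us) ds
  correct-pred {i} {cs} {us} {_} {ds} {y} (_ , dist , mem , upDist , downDist , upAt , downAt) forced =
    ℕP.≤-refl , dist ,
    (λ j 1≤j j≤i → mem j 1≤j (weaken j≤i)) ,
    (λ j j' k k' 1≤j j≤i 1≤j' j'≤i j≢j' p p' eq →
       upDist j j' k k' 1≤j (weaken j≤i) 1≤j' (weaken j'≤i) j≢j' p p' (upDiag-indep k j k' j' i (suc i) eq)) ,
    (λ j j' k k' 1≤j j≤i 1≤j' j'≤i j≢j' p p' eq →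
       downDist j j' k k' 1≤j (weaken j≤i) 1≤j' (weaken j'≤i) j≢j' p p' (downDiag-indep k j k' j' i (suc i) eq)) ,
    upAt′ , downAt′
    where
      weaken : ∀ {j} → j ≤ i → j ≤ suc i
      weaken = ℕP.m≤n⇒m≤1+n

      -- Up diagonal 1 is the new head y; up diagonal l+1 is diagonal l of row i+1.
      upAt′ : ∀ j k l → 1 ≤ j → j ≤ i → KthMember k (num j) cs → 0 < l →
              upDiag {Σs} k j i ≡ + l → KthMember l (num j) (cons y us)
      upAt′ j k 1 1≤j j≤i p _ d =
        subst (λ y → KthMember 1 (num j) (cons y us)) (sym (forced j k 1≤j j≤i p d)) here
      upAt′ j k (suc (suc l)) 1≤j j≤i p _ d =
        there (upAt j k (suc l) 1≤j (weaken j≤i) p (s≤s z≤n) (upDiag-step k j i d))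

      -- Down diagonal l w.r.t. row i is down diagonal l+1 w.r.t. row i+1.
      downAt′ : ∀ j k l → 1 ≤ j → j ≤ i → KthMember k (num j) cs → 0 < l →
                downDiag {Σs} k j i ≡ + l → KthMember l (num j) ds
      downAt′ j k (suc l) 1≤j j≤i p _ d =
        kthMember-tail (downAt j k (suc (suc l)) 1≤j (weaken j≤i) p (s≤s z≤n) (downDiag-step k j i d))

  topQueen : ∀ {m cs us ds} → 1 ≤ m → CorrectUpTo m m cs us ds →
             ∃[ k ] KthMember k (num m) cs × KthMember k (num m) us × KthMember k (num m) ds
  topQueen {m} 1≤m (_ , _ , mem , _ , _ , upAt , downAt) with mem m 1≤m ℕP.≤-refl
  ... | k , p = k , p ,
    upAt m k k 1≤m ℕP.≤-refl p (position-positive p) (diag-self k m) ,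
    downAt m k k 1≤m ℕP.≤-refl p (position-positive p) (diag-self k m)

  pqs-complete : ∀ i (cs us ds t : T) → CorrectUpTo i i cs us ds → MP (pqs (num i) cs us (cons t ds))
  pqs-complete zero    cs us ds t _ = c1 _ _ _
  pqs-complete (suc i) cs us ds t C@(_ , _ , _ , upDist , _)
    with topQueen (s≤s z≤n) C | upHead i cs upDist
  ... | _ , inCs , inUs , inDs | y , forced with kthMember-cons inDs
  ...   | t′ , ds′ , refl =
    c2 (num i) cs us (cons t′ ds′) t y
      (pqs-complete i cs (cons y us) ds′ t′ (correct-pred C forced))
      (pq-at inCs inUs inDs)

mainTheorem3 : (Σs : Signature) → (a : Atom {Σs}) → S0 a → MP a
mainTheorem3 Σs _ (inj₁ (spq k i cs us ds c u d))             = pq-prefix i cs us ds c u d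
mainTheorem3 Σs _ (inj₂ (inj₁ (s0pqs i cs us t ds _ correct))) = pqs-complete i cs us ds t correct
mainTheorem3 Σs _ (inj₂ (inj₂ (spqs0 cs us ds)))              = c1 cs us ds
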